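{- If $G_1$ and $G_2$ are locally equivalent graphs (on the same labeled vertex set), then the quotient graphs in the split decompositions of $G_1$ and $G_2$ are locally equivalent: under the natural correspondence between the quotient graphs of $G_1$ and those of $G_2$ (induced by their common strong split tree, with leaf-nodes and split-nodes identified accordingly), each quotient graph of $G_1$ is locally equivalent to the corresponding quotient graph of $G_2$.
   Context: Local complement $c_v(G)$: replace the subgraph induced on the neighbourhood of $v$ by its complement, leaving all other edges unchanged; locally equivalent graphs are those related by a finite sequence of local complements. A split of a connected graph $G$ is a bipartition $V(G)=U_1\cup U_2$ into nonempty sets such that the edges between $U_1$ and $U_2$ form a complete bipartite graph between the vertices of $U_1$ having a neighbour in $U_2$ and the vertices of $U_2$ having a neighbour in $U_1$; it is trivial if one side is a single vertex. Two splits cross if each side of one meets each side of the other; a split is strong if no other split crosses it. Cunningham's split decomposition: the strong splits of $G$ are the edges of a tree, the strong split tree $SST(G)$, whose leaves are the vertices of $G$; collapsing each nontrivial strong split into a pair of adjacent new "split-nodes" (one on each side, each adjacent to the vertices of its side that had neighbours across the split) and cutting the edge between them, recursively, yields components called quotient graphs (one per internal node of $SST(G)$), each containing leaf-nodes (vertices of $G$) and split-nodes, each being complete, a star, or prime (no nontrivial split). Locally equivalent graphs have the same splits, hence the same strong split tree, which gives a natural bijection between their quotient graphs preserving the vertex labels (leaf-nodes and split-nodes). -}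

module Defs where

open import Data.Nat using (ℕ; zero; suc; _+_)
open import Data.Fin as Fin using (Fin; zero; suc; _↑ˡ_; _↑ʳ_)
open import Data.Bool using (Bool; true; false; _∧_; _∨_; not; if_then_else_)
import Data.Bool as B
open import Data.Product using (Σ; _×_; _,_; ∃-syntax; proj₁; proj₂)
open import Relation.Nullary using (¬_; yes; no)
open import Relation.Nullary.Decidable using (⌊_⌋)
open import Relation.Binary.Definitions using (DecidableEquality)
open import Relation.Binary.PropositionalEquality using (_≡_; _≢_; refl; cong)

Graph : Set → Set
Graph V = V → V → Bool

Simple : {V : Set} → Graph V → Set
Simple G = (∀ x y → G x y ≡ G y x) × (∀ x → G x x ≡ false)

module _ {V : Set} (_≟_ : DecidableEquality V) where

  lc : Graph V → V → Graph V
  lc G v x y =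
    if G v x ∧ G v y ∧ not ⌊ x ≟ y ⌋ then not (G x y) else G x y

  data LocEq : Graph V → Graph V → Set where
    base : {G H : Graph V} → (∀ x y → G x y ≡ H x y) → LocEq G H
    step : {G H : Graph V} (v : V) → LocEq (lc G v) H → LocEq G H

anyFin : (n : ℕ) → (Fin n → Bool) → Bool
anyFin zero    f = false
anyFin (suc n) f = f zero ∨ anyFin n (λ i → f (suc i))

eqb : {n : ℕ} → Fin n → Fin n → Bool
eqb a b = ⌊ a Fin.≟ b ⌋

reachStep : {N : ℕ} → Graph (Fin N) → (Fin N → Bool) → (Fin N → Bool)
reachStep {N} H R c = R c ∨ anyFin N (λ b → R b ∧ H b c)

iter : {A : Set} → ℕ → (A → A) → A → A
iter zero    f a = a
iter (suc m) f a = f (iter m f a)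

-- reach H a c = true iff there is a walk from a to c in H
-- (walks of length ≤ N suffice in a graph on N vertices)
reach : {N : ℕ} → Graph (Fin N) → Fin N → Fin N → Bool
reach {N} H a = iter N (reachStep H) (eqb a)

Connected : {N : ℕ} → Graph (Fin N) → Set
Connected G = ∀ x y → reach G x y ≡ true

removeEdge : {N : ℕ} → Graph (Fin N) → Fin N → Fin N → Graph (Fin N)
removeEdge H a b x y =
  H x y ∧ not ((eqb x a ∧ eqb y b) ∨ (eqb x b ∧ eqb y a))

removeVertex : {N : ℕ} → Graph (Fin N) → Fin N → Graph (Fin N)
removeVertex H u x y = H x y ∧ not (eqb x u) ∧ not (eqb y u)

-- Splits of a graph on Fin n.  A bipartition is given by U : Fin n → Bool
-- (U₁ = U⁻¹ true, U₂ = U⁻¹ false).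

module _ {n : ℕ} (G : Graph (Fin n)) where

  IsSplit : (Fin n → Bool) → Set
  IsSplit U =
    (∃[ x ] U x ≡ true) × (∃[ x ] U x ≡ false) ×
    (∀ x y → U x ≡ true → U y ≡ false →
      (∃[ y' ] (U y' ≡ false × G x y' ≡ true)) →
      (∃[ x' ] (U x' ≡ true × G x' y ≡ true)) →
      G x y ≡ true)

  Crosses : (Fin n → Bool) → (Fin n → Bool) → Set
  Crosses U W =
    (∃[ x ] (U x ≡ true  × W x ≡ true))  ×
    (∃[ x ] (U x ≡ true  × W x ≡ false)) ×
    (∃[ x ] (U x ≡ false × W x ≡ true))  ×
    (∃[ x ] (U x ≡ false × W x ≡ false))

  StrongSplit : (Fin n → Bool) → Set
  StrongSplit U = IsSplit U × (∀ W → IsSplit W → ¬ Crosses U W)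

-- Trees on Fin (n + k): nodes x ↑ˡ k (x : Fin n) are the leaves, i.e.
-- the vertices of G; nodes n ↑ʳ i (i : Fin k) are the internal nodes.

module _ (n k : ℕ) (τ : Graph (Fin (n + k))) where

  leaf : Fin n → Fin (n + k)
  leaf x = x ↑ˡ k

  inner : Fin k → Fin (n + k)
  inner i = n ↑ʳ i

  -- leaf x lies in the branch at node u containing the neighbour a of u,
  -- i.e. x is reachable from a without passing through u
  inBranch : Fin (n + k) → Fin (n + k) → Fin n → Bool
  inBranch u a x = reach (removeVertex τ u) a (leaf x)

  -- the bipartition of the leaves given by the tree edge a–b:
  -- side n k τ a b x = true iff leaf x is on a's side of the edge
  side : Fin (n + k) → Fin (n + k) → Fin n → Bool
  side a b = inBranch b a

record IsSST {n k : ℕ} (G : Graph (Fin n)) (τ : Graph (Fin (n + k))) : Set where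
  field
    tsym   : ∀ a b → τ a b ≡ τ b a
    tirr   : ∀ a → τ a a ≡ false
    tconn  : Connected τ
    tacyc  : ∀ a b → τ a b ≡ true → reach (removeEdge τ a b) a b ≡ false
    leafDeg : ∀ x → ∃[ a ] (τ (leaf n k τ x) a ≡ true ×
                            (∀ b → τ (leaf n k τ x) b ≡ true → b ≡ a))
    innerDeg : ∀ i → ∃[ a ] ∃[ b ] (a ≢ b × τ (inner n k τ i) a ≡ true ×
                                     τ (inner n k τ i) b ≡ true)
    edgeStrong : ∀ a b → τ a b ≡ true → StrongSplit G (side n k τ a b)
    strongEdge : ∀ U → StrongSplit G U →
                 ∃[ a ] ∃[ b ] (τ a b ≡ true × (∀ x → side n k τ a b x ≡ U x))
    edgeInj : ∀ a b c d → τ a b ≡ true → τ c d ≡ true →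
              (∀ x → side n k τ a b x ≡ side n k τ c d x) → (a ≡ c × b ≡ d)

-- Its vertices are the tree-neighbours
-- of u (leaf-nodes = leaves of τ, split-nodes = internal neighbours); the
-- marker vertices of two distinct neighbours a, b are adjacent iff some
-- vertex of G in the branch of a is adjacent in G to some vertex of G in
-- the branch of b.

QVert : {N : ℕ} → Graph (Fin N) → Fin N → Set
QVert τ u = Σ _ (λ a → B.T (τ u a))

T-irr : (b : Bool) (p q : B.T b) → p ≡ q
T-irr true _ _ = refl

qdec : {N : ℕ} (τ : Graph (Fin N)) (u : Fin N) → DecidableEquality (QVert τ u)
qdec τ u (a , p) (b , q) with a Fin.≟ b
... | yes refl = yes (cong (a ,_) (T-irr (τ u a) p q))
... | no a≢b   = no (λ e → a≢b (cong proj₁ e))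

Quotient : {n k : ℕ} → Graph (Fin n) → (τ : Graph (Fin (n + k))) →
           (u : Fin (n + k)) → Graph (QVert τ u)
Quotient {n} {k} G τ u (a , _) (b , _) =
  not (eqb a b) ∧
  anyFin n (λ x → anyFin n (λ y →
    inBranch n k τ u a x ∧ inBranch n k τ u b y ∧ G x y))

-- Fix an internal node u of the tree. Each branch of the tree at u is a side of a
-- strong split of G₁, and local complementation preserves splits, so the branches
-- remain split sides along the whole sequence of local complementations from G₁ to
-- G₂; it suffices to follow one local complementation at a vertex v, which lies in
-- the branch of some marker c. If v has a neighbour outside its branch, the split at
-- c makes v adjacent to every frontier vertex of every branch linked to c, so
-- complementing the neighbourhood of v toggles exactly the links between branches
-- that are both linked to c: the quotient is locally complemented at c. Otherwise
-- the neighbourhood of v lies inside its branch and the quotient is unchanged.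

module Submission where

open import Defs
open import Data.Nat using (ℕ; zero; suc; _+_; _<_; z≤n)
open import Data.Nat.Properties using (≤-<-trans; <-≤-trans; <-irrefl)
open import Data.Fin as Fin using (Fin; zero; suc)
import Data.Fin.Properties as FinP
open import Data.Fin.Subset using (∣_∣; _∈_)
open import Data.Fin.Subset.Properties using (p⊂q⇒∣p∣<∣q∣; ∣p∣≤n)
open import Data.Vec using (tabulate)
open import Data.Vec.Properties using (lookup∘tabulate; []=⇒lookup; lookup⇒[]=)
open import Data.Bool using (Bool; true; false; _∧_; _∨_; not; T)
open import Data.Bool.Properties
  using (∧-conicalˡ; ∧-conicalʳ; ∧-comm; ∧-zeroʳ; ¬-not; not-¬; not-involutive; T-≡; T-irrelevant; ⇔→≡)
open import Data.Product using (_×_; _,_; ∃-syntax; proj₁; proj₂)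
open import Data.Sum using (_⊎_; inj₁; inj₂; map₂)
open import Data.Empty using (⊥; ⊥-elim)
open import Function.Bundles using (Equivalence; mk⇔)
open import Relation.Nullary using (Dec; yes; no; contradiction)
open import Relation.Nullary.Decidable using (_×-dec_)
open import Relation.Binary.Definitions using (DecidableEquality)
open import Relation.Binary.PropositionalEquality
  using (_≡_; _≢_; refl; cong; cong₂; sym; trans; subst; module ≡-Reasoning)

∧-intro : ∀ {a b} → a ≡ true → b ≡ true → a ∧ b ≡ true
∧-intro refl refl = refl

∨-introˡ : ∀ {a} b → a ≡ true → a ∨ b ≡ true
∨-introˡ b refl = refl

∨-introʳ : ∀ a {b} → b ≡ true → a ∨ b ≡ true
∨-introʳ true  _ = refl
∨-introʳ false p = p

∨-elim : ∀ a {b} → a ∨ b ≡ true → a ≡ true ⊎ b ≡ true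
∨-elim true  _ = inj₁ refl
∨-elim false p = inj₂ p

not-true : ∀ {a} → not a ≡ true → a ≡ false
not-true {false} _ = refl

not-false : ∀ {a} → not a ≡ false → a ≡ true
not-false {true} _ = refl

bool-cases : ∀ b {P : Set} → (b ≡ true → P) → (b ≡ false → P) → P
bool-cases true  t _ = t refl
bool-cases false _ f = f refl

module _ {V : Set} where

  infix 4 _≗ᴳ_
  _≗ᴳ_ : Graph V → Graph V → Set
  G ≗ᴳ H = ∀ x y → G x y ≡ H x y

  Symmetric : Graph V → Set
  Symmetric G = ∀ x y → G x y ≡ G y x

  Loopless : Graph V → Set
  Loopless G = ∀ x → G x x ≡ false

eqb-refl : ∀ {N} (a : Fin N) → eqb a a ≡ true
eqb-refl a with a Fin.≟ a
... | yes _ = refl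
... | no a≢a = contradiction refl a≢a

eqb-sound : ∀ {N} {a b : Fin N} → eqb a b ≡ true → a ≡ b
eqb-sound {a = a} {b} p with a Fin.≟ b
... | yes a≡b = a≡b

eqb-false : ∀ {N} {a b : Fin N} → a ≢ b → eqb a b ≡ false
eqb-false {a = a} {b} a≢b with a Fin.≟ b
... | yes a≡b = contradiction a≡b a≢b
... | no _    = refl

anyFin⁺ : ∀ {N} (f : Fin N → Bool) i → f i ≡ true → anyFin N f ≡ true
anyFin⁺ f zero    p = ∨-introˡ _ p
anyFin⁺ f (suc i) p = ∨-introʳ (f zero) (anyFin⁺ (λ j → f (suc j)) i p)

anyFin⁻ : ∀ N (f : Fin N → Bool) → anyFin N f ≡ true → ∃[ i ] f i ≡ true
anyFin⁻ (suc N) f p with ∨-elim (f zero) p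
... | inj₁ q = zero , q
... | inj₂ q with anyFin⁻ N (λ j → f (suc j)) q
...   | i , r = suc i , r

anyFin-cong : ∀ N {f g : Fin N → Bool} → (∀ i → f i ≡ g i) → anyFin N f ≡ anyFin N g
anyFin-cong zero    e = refl
anyFin-cong (suc N) e = cong₂ _∨_ (e zero) (anyFin-cong N (λ i → e (suc i)))

module _ {N : ℕ} where

  infix 4 _⊆ᵇ_
  _⊆ᵇ_ : (Fin N → Bool) → (Fin N → Bool) → Set
  P ⊆ᵇ Q = ∀ i → P i ≡ true → Q i ≡ true

  size : (Fin N → Bool) → ℕ
  size P = ∣ tabulate P ∣

  ∈-tabulate⁺ : ∀ {P : Fin N → Bool} i → P i ≡ true → i ∈ tabulate P
  ∈-tabulate⁺ {P} i Pi = lookup⇒[]= i _ (trans (lookup∘tabulate P i) Pi)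

  ∈-tabulate⁻ : ∀ {P : Fin N → Bool} i → i ∈ tabulate P → P i ≡ true
  ∈-tabulate⁻ {P} i i∈P = trans (sym (lookup∘tabulate P i)) ([]=⇒lookup i∈P)

  size-strict : ∀ {P Q} i → P ⊆ᵇ Q → Q i ≡ true → P i ≡ false → size P < size Q
  size-strict i P⊆Q Qi Pi =
    p⊂q⇒∣p∣<∣q∣ ( (λ {j} j∈P → ∈-tabulate⁺ j (P⊆Q j (∈-tabulate⁻ j j∈P)))
                , i , ∈-tabulate⁺ i Qi , λ i∈P → not-¬ (∈-tabulate⁻ i i∈P) Pi)

  module Stabilisation (f : (Fin N → Bool) → (Fin N → Bool))
                       (inflationary : ∀ P → P ⊆ᵇ f P)
                       (monotone : ∀ {P Q} → P ⊆ᵇ Q → f P ⊆ᵇ f Q) where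

    Closed : (Fin N → Bool) → Set
    Closed P = f P ⊆ᵇ P

    closed-or-grows : ∀ P → Closed P ⊎ size P < size (f P)
    closed-or-grows P with FinP.any? (λ i → (f P i Data.Bool.≟ true) ×-dec (P i Data.Bool.≟ false))
    ... | yes (i , fPi , Pi) = inj₂ (size-strict i (inflationary P) fPi Pi)
    ... | no ¬new = inj₁ λ i fPi → bool-cases (P i) (λ Pi → Pi) (λ Pi → ⊥-elim (¬new (i , fPi , Pi)))

    closed-or-grew : ∀ P m → Closed (iter m f P) ⊎ m < size (iter (suc m) f P)
    closed-or-grew P zero    = map₂ (≤-<-trans z≤n) (closed-or-grows P)
    closed-or-grew P (suc m) with closed-or-grew P m
    ... | inj₁ closed = inj₁ (monotone closed)
    ... | inj₂ m<size = map₂ (≤-<-trans m<size) (closed-or-grows (iter (suc m) f P))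

    iter-closed : ∀ P → Closed (iter N f P)
    iter-closed P with closed-or-grew P N
    ... | inj₁ closed = closed
    ... | inj₂ N<size =
      contradiction (<-≤-trans N<size (∣p∣≤n (tabulate (iter (suc N) f P)))) (<-irrefl refl)

module _ {N : ℕ} (H : Graph (Fin N)) where

  reachStep-elim : ∀ {P} c → reachStep H P c ≡ true →
                   P c ≡ true ⊎ ∃[ b ] (P b ≡ true × H b c ≡ true)
  reachStep-elim {P} c p with ∨-elim (P c) p
  ... | inj₁ Pc = inj₁ Pc
  ... | inj₂ q with anyFin⁻ N _ q
  ...   | b , r = inj₂ (b , ∧-conicalˡ _ _ r , ∧-conicalʳ _ _ r)

  reachStep-inflationary : ∀ P → P ⊆ᵇ reachStep H P
  reachStep-inflationary P c Pc = ∨-introˡ _ Pc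

  reachStep-monotone : ∀ {P Q} → P ⊆ᵇ Q → reachStep H P ⊆ᵇ reachStep H Q
  reachStep-monotone {Q = Q} P⊆Q c p with reachStep-elim c p
  ... | inj₁ Pc = ∨-introˡ _ (P⊆Q c Pc)
  ... | inj₂ (b , Pb , Hbc) = ∨-introʳ (Q c) (anyFin⁺ _ b (∧-intro (P⊆Q b Pb) Hbc))

  open Stabilisation (reachStep H) reachStep-inflationary reachStep-monotone

  reach-refl : ∀ a → reach H a a ≡ true
  reach-refl a = go N
    where
    go : ∀ m → iter m (reachStep H) (eqb a) a ≡ true
    go zero    = eqb-refl a
    go (suc m) = reachStep-inflationary _ a (go m)

  reach-extend : ∀ {a b c} → reach H a b ≡ true → H b c ≡ true → reach H a c ≡ true
  reach-extend {a} {b} {c} ab Hbc =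
    iter-closed (eqb a) c (∨-introʳ (reach H a c) (anyFin⁺ _ b (∧-intro ab Hbc)))

  reach-induction : ∀ {a} (Q : Fin N → Set) → Q a → (∀ {b c} → Q b → H b c ≡ true → Q c) →
                    ∀ c → reach H a c ≡ true → Q c
  reach-induction {a} Q Qa closed = go N
    where
    go : ∀ m c → iter m (reachStep H) (eqb a) c ≡ true → Q c
    go zero    c p = subst Q (eqb-sound p) Qa
    go (suc m) c p with reachStep-elim c p
    ... | inj₁ q             = go m c q
    ... | inj₂ (b , q , Hbc) = closed (go m b q) Hbc

  reach-trans : ∀ {a b c} → reach H a b ≡ true → reach H b c ≡ true → reach H a c ≡ true
  reach-trans {a} ab = reach-induction (λ c → reach H a c ≡ true) ab reach-extend _

  reach-sym : Symmetric H → ∀ {a b} → reach H a b ≡ true → reach H b a ≡ true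
  reach-sym H-sym {a} =
    reach-induction (λ b → reach H b a ≡ true) (reach-refl a)
      (λ {b} {c} ba Hbc → reach-trans (reach-extend (reach-refl c) (trans (H-sym c b) Hbc)) ba) _

reach-mono : ∀ {N} {H H′ : Graph (Fin N)} → (∀ x y → H x y ≡ true → H′ x y ≡ true) →
             ∀ {a c} → reach H a c ≡ true → reach H′ a c ≡ true
reach-mono {H = H} {H′} H⊆H′ {a} =
  reach-induction H (λ c → reach H′ a c ≡ true) (reach-refl H′ a)
    (λ {b} {c} ac Hbc → reach-extend H′ ac (H⊆H′ b c Hbc)) _

module _ {N : ℕ} (τ : Graph (Fin N)) (u : Fin N) where

  private
    τ∖u : Graph (Fin N)
    τ∖u = removeVertex τ u

  removeVertex-sym : Symmetric τ → Symmetric τ∖u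
  removeVertex-sym τ-sym x y rewrite τ-sym x y =
    cong (τ y x ∧_) (∧-comm (not (eqb x u)) (not (eqb y u)))

  removeVertex-edge : ∀ {b c} → τ b c ≡ true → b ≢ u → c ≢ u → τ∖u b c ≡ true
  removeVertex-edge τbc b≢u c≢u rewrite τbc | eqb-false b≢u | eqb-false c≢u = refl

  removeVertex⊆removeEdge : ∀ a x y → τ∖u x y ≡ true → removeEdge τ u a x y ≡ true
  removeVertex⊆removeEdge a x y p with τ x y | eqb x u | eqb y u
  ... | true | false | false rewrite ∧-zeroʳ (eqb x a) = refl

  reach-through-neighbour : ∀ {w} → reach τ u w ≡ true → w ≢ u →
                            ∃[ a ] (τ u a ≡ true × reach τ∖u a w ≡ true)
  reach-through-neighbour = reach-induction τ Q (λ u≢u → contradiction refl u≢u) closed _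
    where
    Q : Fin N → Set
    Q w = w ≢ u → ∃[ a ] (τ u a ≡ true × reach τ∖u a w ≡ true)
    closed : ∀ {b c} → Q b → τ b c ≡ true → Q c
    closed {b} {c} Qb τbc c≢u with b Fin.≟ u
    ... | yes refl = c , τbc , reach-refl τ∖u c
    ... | no b≢u with Qb b≢u
    ...   | a , τua , ab = a , τua , reach-extend τ∖u ab (removeVertex-edge τbc b≢u c≢u)

  branches-disjoint : Symmetric τ → Loopless τ →
                      (∀ a b → τ a b ≡ true → reach (removeEdge τ a b) a b ≡ false) →
                      ∀ {a b w} → τ u a ≡ true → τ u b ≡ true →
                      reach τ∖u a w ≡ true → reach τ∖u b w ≡ true → a ≡ b
  branches-disjoint τ-sym τ-loopless acyclic {a} {b} τua τub aw bw with a Fin.≟ b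
  ... | yes a≡b = a≡b
  ... | no a≢b  = contradiction (acyclic u a τua) (not-¬ cycle)
    where
    τ∖ua : Graph (Fin N)
    τ∖ua = removeEdge τ u a
    u≢a : u ≢ a
    u≢a refl = not-¬ τua (τ-loopless u)
    ub-kept : τ∖ua u b ≡ true
    ub-kept rewrite τub | eqb-refl u | eqb-false (λ b≡a → a≢b (sym b≡a)) | eqb-false u≢a = refl
    ba : reach τ∖u b a ≡ true
    ba = reach-trans τ∖u bw (reach-sym τ∖u (removeVertex-sym τ-sym) aw)
    cycle : reach τ∖ua u a ≡ true
    cycle = reach-trans τ∖ua (reach-extend τ∖ua (reach-refl τ∖ua u) ub-kept)
                             (reach-mono (removeVertex⊆removeEdge a) ba)

leaf≢inner : ∀ n k τ (x : Fin n) (i : Fin k) → leaf n k τ x ≢ inner n k τ i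
leaf≢inner n k τ x i e
  with trans (sym (FinP.splitAt-↑ˡ n x k)) (trans (cong (Fin.splitAt n) e) (FinP.splitAt-↑ʳ n k i))
... | ()

module _ {V : Set} where

  CompleteFrontiers : Graph V → (V → Bool) → Set
  CompleteFrontiers G U =
    ∀ x y → U x ≡ true → U y ≡ false →
    (∃[ y′ ] (U y′ ≡ false × G x y′ ≡ true)) →
    (∃[ x′ ] (U x′ ≡ true × G x′ y ≡ true)) →
    G x y ≡ true

  sides-distinct : ∀ {U : V → Bool} {x y} → U x ≡ true → U y ≡ false → x ≢ y
  sides-distinct Ux Uy refl = not-¬ Ux Uy

  frontiers-cong : ∀ {G U W} → (∀ x → U x ≡ W x) → CompleteFrontiers G U → CompleteFrontiers G W
  frontiers-cong U≗W split x y Wx Wy (y′ , Wy′ , Gxy′) (x′ , Wx′ , Gx′y) =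
    split x y (trans (U≗W x) Wx) (trans (U≗W y) Wy)
          (y′ , trans (U≗W y′) Wy′ , Gxy′) (x′ , trans (U≗W x′) Wx′ , Gx′y)

  frontiers-complement : ∀ {G U} → Symmetric G → CompleteFrontiers G U →
                         CompleteFrontiers G (λ x → not (U x))
  frontiers-complement {G} G-sym split x y ¬Ux ¬Uy (y′ , ¬Uy′ , Gxy′) (x′ , ¬Ux′ , Gx′y) =
    trans (G-sym x y) (split y x (not-false ¬Uy) (not-true ¬Ux)
                             (x′ , not-true ¬Ux′ , trans (G-sym y x′) Gx′y)
                             (y′ , not-false ¬Uy′ , trans (G-sym y′ x) Gxy′))

  module _ (_≟_ : DecidableEquality V) where

    lc-offˡ : ∀ {G v x} y → G v x ≡ false → lc _≟_ G v x y ≡ G x y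
    lc-offˡ y Gvx rewrite Gvx = refl

    lc-offʳ : ∀ {G v} x {y} → G v y ≡ false → lc _≟_ G v x y ≡ G x y
    lc-offʳ {G} {v} x Gvy rewrite Gvy | ∧-zeroʳ (G v x) = refl

    lc-on : ∀ {G v x y} → G v x ≡ true → G v y ≡ true → x ≢ y → lc _≟_ G v x y ≡ not (G x y)
    lc-on {x = x} {y} Gvx Gvy x≢y rewrite Gvx | Gvy with x ≟ y
    ... | yes x≡y = contradiction x≡y x≢y
    ... | no _    = refl

    lc-diag : ∀ {G v x y} → x ≡ y → lc _≟_ G v x y ≡ G x y
    lc-diag {G} {v} {x} refl with x ≟ x | G v x
    ... | yes _   | true  = refl
    ... | yes _   | false = refl
    ... | no x≢x  | _     = contradiction refl x≢x

    lc-sym : ∀ {G} v → Symmetric G → Symmetric (lc _≟_ G v)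
    lc-sym {G} v G-sym x y = by-cases (x ≟ y)
      where
      by-cases : Dec (x ≡ y) → lc _≟_ G v x y ≡ lc _≟_ G v y x
      by-cases (yes x≡y) = trans (lc-diag {G} {v} x≡y) (trans (G-sym x y) (sym (lc-diag {G} {v} (sym x≡y))))
      by-cases (no x≢y)  = bool-cases (G v x)
        (λ Gvx → bool-cases (G v y)
          (λ Gvy → trans (lc-on {G} Gvx Gvy x≢y)
                         (trans (cong not (G-sym x y)) (sym (lc-on {G} Gvy Gvx (λ y≡x → x≢y (sym y≡x))))))
          (λ Gvy → trans (lc-offʳ {G} x Gvy) (trans (G-sym x y) (sym (lc-offˡ {G} x Gvy)))))
        (λ Gvx → trans (lc-offˡ {G} y Gvx) (trans (G-sym x y) (sym (lc-offʳ {G} y Gvx))))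

    lc-loopless : ∀ {G} v → Loopless G → Loopless (lc _≟_ G v)
    lc-loopless {G} v loopless x = trans (lc-diag {G} {v} refl) (loopless x)

    lc-cong : ∀ {G H} v → G ≗ᴳ H → lc _≟_ G v ≗ᴳ lc _≟_ H v
    lc-cong v G≗H x y rewrite G≗H v x | G≗H v y | G≗H x y = refl

    LocEq-respˡ : ∀ {G G′ H} → G ≗ᴳ G′ → LocEq _≟_ G′ H → LocEq _≟_ G H
    LocEq-respˡ G≗G′ (base G′≗H)    = base (λ x y → trans (G≗G′ x y) (G′≗H x y))
    LocEq-respˡ G≗G′ (step v G′~H) = step v (LocEq-respˡ (lc-cong v G≗G′) G′~H)

    lc-frontiers-inside : ∀ {G U v} → CompleteFrontiers G U → U v ≡ true →
                          CompleteFrontiers (lc _≟_ G v) U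
    lc-frontiers-inside {G} {U} {v} split Uv x y Ux Uy (y′ , Uy′ , Lxy′) (x′ , Ux′ , Lx′y) =
      bool-cases (G v y) v~y v≁y
      where
      v~y : G v y ≡ true → lc _≟_ G v x y ≡ true
      v~y Gvy = bool-cases (G v x) v~x v≁x
        where
        ¬Gxy : G v x ≡ true → G x y ≡ true → ⊥
        ¬Gxy Gvx Gxy = bool-cases (G v y′)
          (λ Gvy′ → not-¬ (split x y′ Ux Uy′ (y , Uy , Gxy) (v , Uv , Gvy′))
                          (not-true (trans (sym (lc-on {G} Gvx Gvy′ (sides-distinct Ux Uy′))) Lxy′)))
          (λ Gvy′ → not-¬ (split v y′ Uv Uy′ (y , Uy , Gvy)
                                 (x , Ux , trans (sym (lc-offʳ {G} x Gvy′)) Lxy′))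
                          Gvy′)
        v~x : G v x ≡ true → lc _≟_ G v x y ≡ true
        v~x Gvx = trans (lc-on {G} Gvx Gvy (sides-distinct Ux Uy)) (cong not (¬-not (¬Gxy Gvx)))
        v≁x : G v x ≡ false → lc _≟_ G v x y ≡ true
        v≁x Gvx = trans (lc-offˡ {G} y Gvx)
                        (split x y Ux Uy (y′ , Uy′ , trans (sym (lc-offˡ {G} y′ Gvx)) Lxy′) (v , Uv , Gvy))
      v≁y : G v y ≡ false → lc _≟_ G v x y ≡ true
      v≁y Gvy = trans (lc-offʳ {G} x Gvy) (split x y Ux Uy (y′ , Uy′ , Gxy′) (x′ , Ux′ , Gx′y))
        where
        Gx′y : G x′ y ≡ true
        Gx′y = trans (sym (lc-offʳ {G} x′ Gvy)) Lx′y
        Gxy′ : G x y′ ≡ true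
        Gxy′ = bool-cases (G v y′)
          (λ Gvy′ → contradiction Gvy (not-¬ (split v y Uv Uy (y′ , Uy′ , Gvy′) (x′ , Ux′ , Gx′y))))
          (λ Gvy′ → trans (sym (lc-offʳ {G} x Gvy′)) Lxy′)

    lc-frontiers : ∀ {G U} v → Symmetric G → CompleteFrontiers G U → CompleteFrontiers (lc _≟_ G v) U
    lc-frontiers {G} {U} v G-sym split = bool-cases (U v) (lc-frontiers-inside split) outside
      where
      outside : U v ≡ false → CompleteFrontiers (lc _≟_ G v) U
      outside Uv = frontiers-cong (λ x → not-involutive (U x))
                     (frontiers-complement (lc-sym v G-sym)
                       (lc-frontiers-inside (frontiers-complement G-sym split) (cong not Uv)))

module _ {n : ℕ} where

  Disjoint : (Fin n → Bool) → (Fin n → Bool) → Set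
  Disjoint A B = ∀ x → A x ≡ true → B x ≡ false

  disjoint-sym : ∀ {A B} → Disjoint A B → Disjoint B A
  disjoint-sym A#B x Bx = ¬-not (λ Ax → not-¬ Bx (A#B x Ax))

  -- Opaque so that G, A and B are inferable from linked G A B; the quotient graph is
  -- related to it by quotient-off-diag.
  opaque
    linked : Graph (Fin n) → (Fin n → Bool) → (Fin n → Bool) → Bool
    linked G A B = anyFin n (λ x → anyFin n (λ y → A x ∧ B y ∧ G x y))

    linked⁺ : ∀ {G A B x y} → A x ≡ true → B y ≡ true → G x y ≡ true → linked G A B ≡ true
    linked⁺ {x = x} {y} Ax By Gxy = anyFin⁺ _ x (anyFin⁺ _ y (∧-intro Ax (∧-intro By Gxy)))

    linked-elim : ∀ {G A B} {P : Set} → (∀ {x y} → A x ≡ true → B y ≡ true → G x y ≡ true → P) →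
                  linked G A B ≡ true → P
    linked-elim {G} {A} {B} f p with anyFin⁻ n _ p
    ... | x , q with anyFin⁻ n _ q
    ...   | y , r = f (∧-conicalˡ (A x) _ r) (∧-conicalˡ (B y) _ By∧Gxy) (∧-conicalʳ (B y) _ By∧Gxy)
      where
      By∧Gxy : B y ∧ G x y ≡ true
      By∧Gxy = ∧-conicalʳ (A x) _ r

    linked-cong : ∀ {G H} A B → G ≗ᴳ H → linked G A B ≡ linked H A B
    linked-cong A B G≗H =
      anyFin-cong n (λ x → anyFin-cong n (λ y → cong (λ e → A x ∧ B y ∧ e) (G≗H x y)))

  linked-≡ : ∀ {G H A B} →
             (∀ {x y} → A x ≡ true → B y ≡ true → G x y ≡ true → linked H A B ≡ true) →
             (∀ {x y} → A x ≡ true → B y ≡ true → H x y ≡ true → linked G A B ≡ true) →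
             linked G A B ≡ linked H A B
  linked-≡ G⇒H H⇒G = ⇔→≡ {z = true} (mk⇔ (linked-elim G⇒H) (linked-elim H⇒G))

  linked-sym : ∀ {G A B} → Symmetric G → linked G A B ≡ linked G B A
  linked-sym G-sym =
    ⇔→≡ {z = true} (mk⇔ (linked-elim (λ Ax By Gxy → linked⁺ By Ax (trans (G-sym _ _) Gxy)))
                        (linked-elim (λ Bx Ay Gxy → linked⁺ Ay Bx (trans (G-sym _ _) Gxy))))

  frontiers-adjacent : ∀ {G A B} → Symmetric G → Disjoint A B →
                       CompleteFrontiers G A → CompleteFrontiers G B → linked G A B ≡ true →
                       ∀ {x y} → A x ≡ true → B y ≡ true →
                       (∃[ x′ ] (A x′ ≡ false × G x x′ ≡ true)) →
                       (∃[ y′ ] (B y′ ≡ false × G y y′ ≡ true)) →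
                       G x y ≡ true
  frontiers-adjacent {G} {A} {B} G-sym A#B A-split B-split AB {x} {y} Ax By x-out y-out =
    linked-elim across AB
    where
    across : ∀ {x₀ y₀} → A x₀ ≡ true → B y₀ ≡ true → G x₀ y₀ ≡ true → G x y ≡ true
    across {x₀} {y₀} Ax₀ By₀ Gx₀y₀ = A-split x y Ax (disjoint-sym A#B y By) x-out (x₀ , Ax₀ , Gx₀y)
      where
      Gyx₀ = B-split y x₀ By (A#B x₀ Ax₀) y-out (y₀ , By₀ , trans (G-sym y₀ x₀) Gx₀y₀)
      Gx₀y = trans (G-sym x₀ y) Gyx₀

  module _ {G : Graph (Fin n)} {v : Fin n} where

    private
      L : Graph (Fin n)
      L = lc Fin._≟_ G v

    linked-lc-source : ∀ {A B} → Loopless G → A v ≡ true → linked L A B ≡ linked G A B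
    linked-lc-source {A} {B} loopless Av = linked-≡ L⇒G G⇒L
      where
      L⇒G : ∀ {x y} → A x ≡ true → B y ≡ true → L x y ≡ true → linked G A B ≡ true
      L⇒G {x} {y} Ax By Lxy = bool-cases (G v y)
        (λ Gvy → linked⁺ Av By Gvy)
        (λ Gvy → linked⁺ Ax By (trans (sym (lc-offʳ Fin._≟_ {G} x Gvy)) Lxy))
      G⇒L : ∀ {x y} → A x ≡ true → B y ≡ true → G x y ≡ true → linked L A B ≡ true
      G⇒L {x} {y} Ax By Gxy = bool-cases (G v y)
        (λ Gvy → linked⁺ Av By (trans (lc-offˡ Fin._≟_ {G} y (loopless v)) Gvy))
        (λ Gvy → linked⁺ Ax By (trans (lc-offʳ Fin._≟_ {G} x Gvy) Gxy))

    linked-lc-apart : ∀ {A B} → (∀ x → A x ≡ true → G v x ≡ false) → linked L A B ≡ linked G A B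
    linked-lc-apart {A} {B} apart = linked-≡
      (λ {x} {y} Ax By Lxy → linked⁺ Ax By (trans (sym (lc-offˡ Fin._≟_ {G} y (apart x Ax))) Lxy))
      (λ {x} {y} Ax By Gxy → linked⁺ Ax By (trans (lc-offˡ Fin._≟_ {G} y (apart x Ax)) Gxy))

    linked-lc-apartʳ : ∀ {A B} → Symmetric G → (∀ y → B y ≡ true → G v y ≡ false) →
                       linked L A B ≡ linked G A B
    linked-lc-apartʳ {A} {B} G-sym apart = begin
      linked L A B ≡⟨ linked-sym (lc-sym Fin._≟_ {G} v G-sym) ⟩
      linked L B A ≡⟨ linked-lc-apart apart ⟩
      linked G B A ≡⟨ linked-sym G-sym ⟩
      linked G A B ∎
      where open ≡-Reasoning

    -- Since v is a frontier vertex of C, it is adjacent to all frontier vertices of A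
    -- and B, which are the only vertices carrying A–B edges.
    linked-lc-flip : ∀ {A B C} → Symmetric G →
                     Disjoint A B → Disjoint A C → Disjoint B C →
                     CompleteFrontiers G A → CompleteFrontiers G B → CompleteFrontiers G C →
                     C v ≡ true → (∃[ y₀ ] (C y₀ ≡ false × G v y₀ ≡ true)) →
                     linked G C A ≡ true → linked G C B ≡ true →
                     linked L A B ≡ not (linked G A B)
    linked-lc-flip {A} {B} {C} G-sym A#B A#C B#C A-split B-split C-split Cv v-out CA CB =
      bool-cases (linked G A B) flip-linked flip-unlinked
      where
      adjacent-to-v : ∀ {D} → Disjoint D C → CompleteFrontiers G D → linked G C D ≡ true →
                      ∀ {x} → D x ≡ true → (∃[ y ] (D y ≡ false × G x y ≡ true)) → G v x ≡ true
      adjacent-to-v {D} D#C D-split CD Dx x-out =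
        frontiers-adjacent G-sym (disjoint-sym D#C) C-split D-split CD Cv Dx v-out x-out

      some-adjacent-to-v : ∀ {D} → Disjoint D C → CompleteFrontiers G D → linked G C D ≡ true →
                           ∃[ x ] (D x ≡ true × G v x ≡ true)
      some-adjacent-to-v {D} D#C D-split CD = linked-elim witness CD
        where
        witness : ∀ {x₁ x} → C x₁ ≡ true → D x ≡ true → G x₁ x ≡ true →
                  ∃[ x ] (D x ≡ true × G v x ≡ true)
        witness {x₁} {x} Cx₁ Dx Gx₁x =
          x , Dx , adjacent-to-v D#C D-split CD Dx (x₁ , disjoint-sym D#C x₁ Cx₁ , trans (G-sym x x₁) Gx₁x)

      x≢y : ∀ {x y} → A x ≡ true → B y ≡ true → x ≢ y
      x≢y Ax By = sides-distinct {U = A} Ax (disjoint-sym A#B _ By)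

      flip-linked : linked G A B ≡ true → linked L A B ≡ not (linked G A B)
      flip-linked AB = trans (¬-not (linked-elim no-edge)) (cong not (sym AB))
        where
        no-edge : ∀ {x y} → A x ≡ true → B y ≡ true → L x y ≡ true → ⊥
        no-edge {x} {y} Ax By Lxy = bool-cases (G x y) kept added
          where
          kept : G x y ≡ true → ⊥
          kept Gxy = not-¬ Lxy (trans (lc-on Fin._≟_ {G} Gvx Gvy (x≢y Ax By)) (cong not Gxy))
            where
            Gvx = adjacent-to-v A#C A-split CA Ax (y , disjoint-sym A#B y By , Gxy)
            Gvy = adjacent-to-v B#C B-split CB By (x , A#B x Ax , trans (G-sym y x) Gxy)
          added : G x y ≡ false → ⊥
          added Gxy = not-¬ (frontiers-adjacent G-sym A#B A-split B-split AB Ax By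
                               (v , disjoint-sym A#C v Cv , trans (G-sym x v) Gvx)
                               (v , disjoint-sym B#C v Cv , trans (G-sym y v) Gvy))
                            Gxy
            where
            Gvx = bool-cases (G v x) (λ Gvx → Gvx)
                    (λ Gvx → contradiction (trans (lc-offˡ Fin._≟_ {G} y Gvx) Gxy) (not-¬ Lxy))
            Gvy = bool-cases (G v y) (λ Gvy → Gvy)
                    (λ Gvy → contradiction (trans (lc-offʳ Fin._≟_ {G} x Gvy) Gxy) (not-¬ Lxy))

      flip-unlinked : linked G A B ≡ false → linked L A B ≡ not (linked G A B)
      flip-unlinked AB with some-adjacent-to-v A#C A-split CA | some-adjacent-to-v B#C B-split CB
      ... | x , Ax , Gvx | y , By , Gvy =
        trans (linked⁺ Ax By (trans (lc-on Fin._≟_ {G} Gvx Gvy (x≢y Ax By)) (cong not Gxy)))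
              (cong not (sym AB))
        where
        Gxy : G x y ≡ false
        Gxy = ¬-not (λ Gxy → not-¬ (linked⁺ Ax By Gxy) AB)

module _ {n k : ℕ} (τ : Graph (Fin (n + k))) (u : Fin (n + k)) where

  private
    branch : Fin (n + k) → Fin n → Bool
    branch = inBranch n k τ u

    edge : ∀ {a} → T (τ u a) → τ u a ≡ true
    edge = Equivalence.to T-≡

  BranchesDisjoint : Set
  BranchesDisjoint = ∀ {a b} → τ u a ≡ true → τ u b ≡ true → a ≢ b → Disjoint (branch a) (branch b)

  BranchesCover : Set
  BranchesCover = ∀ x → ∃[ a ] (τ u a ≡ true × branch a x ≡ true)

  marker : ∀ {a} → τ u a ≡ true → QVert τ u
  marker {a} τua = a , Equivalence.from T-≡ τua

  marker-≡ : ∀ {a b} (pa : T (τ u a)) (pb : T (τ u b)) → a ≡ b → (a , pa) ≡ (b , pb)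
  marker-≡ {a} pa pb refl = cong (a ,_) (T-irrelevant pa pb)

  quotient-diag : ∀ (G : Graph (Fin n)) {a b} (pa : T (τ u a)) (pb : T (τ u b)) → a ≡ b →
                  Quotient G τ u (a , pa) (b , pb) ≡ false
  quotient-diag G {a} pa pb refl rewrite eqb-refl a = refl

  opaque
    unfolding linked

    quotient-off-diag : ∀ (G : Graph (Fin n)) {a b} (pa : T (τ u a)) (pb : T (τ u b)) → a ≢ b →
                        Quotient G τ u (a , pa) (b , pb) ≡ linked G (branch a) (branch b)
    quotient-off-diag G pa pb a≢b rewrite eqb-false a≢b = refl

  quotient-resp-linked : ∀ {G H : Graph (Fin n)} →
                         (∀ {a b} → τ u a ≡ true → τ u b ≡ true → a ≢ b →
                                    linked G (branch a) (branch b) ≡ linked H (branch a) (branch b)) →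
                         Quotient G τ u ≗ᴳ Quotient H τ u
  quotient-resp-linked {G} {H} same (a , pa) (b , pb) = by-cases (a Fin.≟ b)
    where
    open ≡-Reasoning
    by-cases : Dec (a ≡ b) → Quotient G τ u (a , pa) (b , pb) ≡ Quotient H τ u (a , pa) (b , pb)
    by-cases (yes a≡b) = trans (quotient-diag G pa pb a≡b) (sym (quotient-diag H pa pb a≡b))
    by-cases (no a≢b)  = begin
      Quotient G τ u (a , pa) (b , pb) ≡⟨ quotient-off-diag G pa pb a≢b ⟩
      linked G (branch a) (branch b)   ≡⟨ same (edge pa) (edge pb) a≢b ⟩
      linked H (branch a) (branch b)   ≡⟨ sym (quotient-off-diag H pa pb a≢b) ⟩
      Quotient H τ u (a , pa) (b , pb) ∎

  quotient-cong : ∀ {G H : Graph (Fin n)} → G ≗ᴳ H → Quotient G τ u ≗ᴳ Quotient H τ u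
  quotient-cong G≗H = quotient-resp-linked (λ {a} {b} _ _ _ → linked-cong (branch a) (branch b) G≗H)

  record BranchesSplit (G : Graph (Fin n)) : Set where
    field
      symmetric : Symmetric G
      loopless  : Loopless G
      splits    : ∀ a → τ u a ≡ true → CompleteFrontiers G (branch a)

  lc-branchesSplit : ∀ {G : Graph (Fin n)} v → BranchesSplit G → BranchesSplit (lc Fin._≟_ G v)
  lc-branchesSplit {G} v G-split = record
    { symmetric = lc-sym Fin._≟_ {G} v symmetric
    ; loopless  = lc-loopless Fin._≟_ {G} v loopless
    ; splits    = λ a τua → lc-frontiers Fin._≟_ {G} v symmetric (splits a τua)
    }
    where open BranchesSplit G-split

  module _ (disjoint : BranchesDisjoint) {G : Graph (Fin n)} (G-split : BranchesSplit G)
           {v : Fin n} {c : Fin (n + k)} (τuc : τ u c ≡ true) (cv : branch c v ≡ true) where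

    open BranchesSplit G-split
    open ≡-Reasoning

    private
      L : Graph (Fin n)
      L = lc Fin._≟_ G v

      Q : Graph (QVert τ u)
      Q = Quotient G τ u

      ĉ : QVert τ u
      ĉ = marker τuc

      lcQ : Graph (QVert τ u)
      lcQ = lc (qdec τ u) Q ĉ

      ĉ-loopless : (pc : T (τ u c)) → Q ĉ (c , pc) ≡ false
      ĉ-loopless pc = quotient-diag G (proj₂ ĉ) pc refl

      apart-from-v : ∀ {a} → linked G (branch c) (branch a) ≡ false →
                     ∀ x → branch a x ≡ true → G v x ≡ false
      apart-from-v ca x ax = ¬-not (λ Gvx → not-¬ (linked⁺ cv ax Gvx) ca)

    quotient-lc-interior : (∀ y → branch c y ≡ false → G v y ≡ false) → Quotient L τ u ≗ᴳ Q
    quotient-lc-interior interior = quotient-resp-linked same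
      where
      same : ∀ {a b} → τ u a ≡ true → τ u b ≡ true → a ≢ b →
             linked L (branch a) (branch b) ≡ linked G (branch a) (branch b)
      same {a} τua _ _ with c Fin.≟ a
      ... | yes refl = linked-lc-source loopless cv
      ... | no c≢a   =
        linked-lc-apart (λ x ax → interior x (disjoint τua τuc (λ a≡c → c≢a (sym a≡c)) x ax))

    quotient-lc-frontier-away : ∀ {y₀ a b} (pa : T (τ u a)) (pb : T (τ u b)) →
                                branch c y₀ ≡ false → G v y₀ ≡ true → a ≢ b → c ≢ a → c ≢ b →
                                Quotient L τ u (a , pa) (b , pb) ≡ lcQ (a , pa) (b , pb)
    quotient-lc-frontier-away {y₀} {a} {b} pa pb cy₀ Gvy₀ a≢b c≢a c≢b =
      trans L-ab (bool-cases (linked G C A) (λ CA → bool-cases (linked G C B) (both CA) apartʳ) apartˡ)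
      where
      A = branch a
      B = branch b
      C = branch c
      ĉa : Q ĉ (a , pa) ≡ linked G C A
      ĉa = quotient-off-diag G (proj₂ ĉ) pa c≢a
      ĉb : Q ĉ (b , pb) ≡ linked G C B
      ĉb = quotient-off-diag G (proj₂ ĉ) pb c≢b
      L-ab : Quotient L τ u (a , pa) (b , pb) ≡ linked L A B
      L-ab = quotient-off-diag L pa pb a≢b
      G-ab : linked G A B ≡ Q (a , pa) (b , pb)
      G-ab = sym (quotient-off-diag G pa pb a≢b)
      apartˡ : linked G C A ≡ false → linked L A B ≡ lcQ (a , pa) (b , pb)
      apartˡ CA = begin
        linked L A B          ≡⟨ linked-lc-apart (apart-from-v CA) ⟩
        linked G A B          ≡⟨ G-ab ⟩
        Q (a , pa) (b , pb)   ≡⟨ sym (lc-offˡ (qdec τ u) {Q} {ĉ} (b , pb) (trans ĉa CA)) ⟩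
        lcQ (a , pa) (b , pb) ∎
      apartʳ : linked G C B ≡ false → linked L A B ≡ lcQ (a , pa) (b , pb)
      apartʳ CB = begin
        linked L A B          ≡⟨ linked-lc-apartʳ symmetric (apart-from-v CB) ⟩
        linked G A B          ≡⟨ G-ab ⟩
        Q (a , pa) (b , pb)   ≡⟨ sym (lc-offʳ (qdec τ u) {Q} {ĉ} (a , pa) (trans ĉb CB)) ⟩
        lcQ (a , pa) (b , pb) ∎
      both : linked G C A ≡ true → linked G C B ≡ true → linked L A B ≡ lcQ (a , pa) (b , pb)
      both CA CB = begin
        linked L A B              ≡⟨ linked-lc-flip symmetric (disjoint τua τub a≢b)
                                       (disjoint τua τuc (λ a≡c → c≢a (sym a≡c)))
                                       (disjoint τub τuc (λ b≡c → c≢b (sym b≡c)))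
                                       (splits a τua) (splits b τub) (splits c τuc)
                                       cv (y₀ , cy₀ , Gvy₀) CA CB ⟩
        not (linked G A B)        ≡⟨ cong not G-ab ⟩
        not (Q (a , pa) (b , pb)) ≡⟨ sym (lc-on (qdec τ u) {Q} {ĉ} (trans ĉa CA) (trans ĉb CB)
                                               (λ p≡q → a≢b (cong proj₁ p≡q))) ⟩
        lcQ (a , pa) (b , pb)     ∎
        where
        τua = edge pa
        τub = edge pb

    quotient-lc-frontier : ∀ {y₀} → branch c y₀ ≡ false → G v y₀ ≡ true → Quotient L τ u ≗ᴳ lcQ
    quotient-lc-frontier {y₀} cy₀ Gvy₀ (a , pa) (b , pb) = by-cases (a Fin.≟ b) (c Fin.≟ a) (c Fin.≟ b)
      where
      by-cases : Dec (a ≡ b) → Dec (c ≡ a) → Dec (c ≡ b) →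
                 Quotient L τ u (a , pa) (b , pb) ≡ lcQ (a , pa) (b , pb)
      by-cases (yes a≡b) _ _ = begin
        Quotient L τ u (a , pa) (b , pb) ≡⟨ quotient-diag L pa pb a≡b ⟩
        false                            ≡⟨ sym (quotient-diag G pa pb a≡b) ⟩
        Q (a , pa) (b , pb)              ≡⟨ sym (lc-diag (qdec τ u) {Q} {ĉ} (marker-≡ pa pb a≡b)) ⟩
        lcQ (a , pa) (b , pb)            ∎
      by-cases (no a≢b) (yes refl) _ = begin
        Quotient L τ u (c , pa) (b , pb) ≡⟨ quotient-off-diag L pa pb a≢b ⟩
        linked L (branch c) (branch b)   ≡⟨ linked-lc-source loopless cv ⟩
        linked G (branch c) (branch b)   ≡⟨ sym (quotient-off-diag G pa pb a≢b) ⟩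
        Q (c , pa) (b , pb)              ≡⟨ sym (lc-offˡ (qdec τ u) {Q} {ĉ} (b , pb) (ĉ-loopless pa)) ⟩
        lcQ (c , pa) (b , pb)            ∎
      by-cases (no a≢b) (no _) (yes refl) = begin
        Quotient L τ u (a , pa) (c , pb) ≡⟨ quotient-off-diag L pa pb a≢b ⟩
        linked L (branch a) (branch c)   ≡⟨ linked-sym (lc-sym Fin._≟_ {G} v symmetric) ⟩
        linked L (branch c) (branch a)   ≡⟨ linked-lc-source loopless cv ⟩
        linked G (branch c) (branch a)   ≡⟨ linked-sym symmetric ⟩
        linked G (branch a) (branch c)   ≡⟨ sym (quotient-off-diag G pa pb a≢b) ⟩
        Q (a , pa) (c , pb)              ≡⟨ sym (lc-offʳ (qdec τ u) {Q} {ĉ} (a , pa) (ĉ-loopless pb)) ⟩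
        lcQ (a , pa) (c , pb)            ∎
      by-cases (no a≢b) (no c≢a) (no c≢b) = quotient-lc-frontier-away pa pb cy₀ Gvy₀ a≢b c≢a c≢b

  module _ (disjoint : BranchesDisjoint) (cover : BranchesCover) where

    quotient-lc-step : ∀ {G K} v → BranchesSplit G →
                       LocEq (qdec τ u) (Quotient (lc Fin._≟_ G v) τ u) K → LocEq (qdec τ u) (Quotient G τ u) K
    quotient-lc-step {G} v G-split lcQ~K with cover v
    ... | c , τuc , cv with FinP.any? (λ y → (branch c y Data.Bool.≟ false) ×-dec (G v y Data.Bool.≟ true))
    ...   | yes (y₀ , cy₀ , Gvy₀) =
      step (marker τuc)
           (LocEq-respˡ (qdec τ u)
                        (λ p q → sym (quotient-lc-frontier disjoint G-split τuc cv cy₀ Gvy₀ p q)) lcQ~K)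
    ...   | no interior =
      LocEq-respˡ (qdec τ u) (λ p q → sym (quotient-lc-interior disjoint G-split τuc cv v-interior p q)) lcQ~K
      where
      v-interior : ∀ y → branch c y ≡ false → G v y ≡ false
      v-interior y cy = ¬-not (λ Gvy → interior (y , cy , Gvy))

    quotient-locEq : ∀ {G H} → BranchesSplit G → LocEq Fin._≟_ G H →
                     LocEq (qdec τ u) (Quotient G τ u) (Quotient H τ u)
    quotient-locEq G-split (base G≗H)    = base (quotient-cong G≗H)
    quotient-locEq G-split (step v lcG~H) =
      quotient-lc-step v G-split (quotient-locEq (lc-branchesSplit v G-split) lcG~H)

theorem3 : {n k : ℕ} (G₁ G₂ : Graph (Fin n)) (τ : Graph (Fin (n + k))) →
           Simple G₁ → Simple G₂ → Connected G₁ → Connected G₂ →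
           LocEq Fin._≟_ G₁ G₂ →
           IsSST G₁ τ → IsSST G₂ τ →
           (i : Fin k) →
           LocEq (qdec τ (inner n k τ i))
                 (Quotient G₁ τ (inner n k τ i)) (Quotient G₂ τ (inner n k τ i))
theorem3 {n} {k} G₁ G₂ τ (G₁-sym , G₁-loopless) _ _ _ G₁~G₂ sst _ i =
  quotient-locEq τ u disjoint cover G₁-split G₁~G₂
  where
  open IsSST sst
  u = inner n k τ i
  disjoint : BranchesDisjoint τ u
  disjoint τua τub a≢b x ax = ¬-not (λ bx → a≢b (branches-disjoint τ u tsym tirr tacyc τua τub ax bx))
  cover : BranchesCover τ u
  cover x = reach-through-neighbour τ u (tconn u (leaf n k τ x)) (leaf≢inner n k τ x i)
  G₁-split : BranchesSplit τ u G₁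
  G₁-split = record
    { symmetric = G₁-sym
    ; loopless  = G₁-loopless
    ; splits    = λ a τua → proj₂ (proj₂ (proj₁ (edgeStrong a u (trans (tsym a u) τua))))
    }
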